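{- For every integer $n\geq 4$ with $n \neq 5$, there exists a $0,1$ matrix $M$ of size $n \times n$ such that for all integers $k \geq 1$, $\mathrm{rank}_{\mathbb{R}}(M^{\otimes k}) = (\lfloor n/2\rfloor + 1)^k$ and $\mathrm{rank}_{\mathrm{bin}}(M^{\otimes k}) = (2\lfloor n/2\rfloor)^{k}$.
   Context: For matrices $A$ ($n\times m$) and $B$, the Kronecker product $A\otimes B$ is the block matrix whose $(i,j)$ block is $A_{i,j}\cdot B$. $M^{\otimes 1}=M$ and $M^{\otimes k} = M\otimes M^{\otimes (k-1)}$ for $k\ge 2$. $\mathrm{rank}_{\mathbb{R}}$ is the rank over the reals. The binary rank $\mathrm{rank}_{\mathrm{bin}}(M)$ of a $0,1$ matrix $M$ of size $p\times q$ is the minimal $d$ with $M=A\cdot B$, $A$ a $0,1$ matrix of size $p\times d$, $B$ a $0,1$ matrix of size $d\times q$, product over the integers; equivalently the minimum number of pairwise disjoint all-ones submatrices partitioning the $1$-entries of $M$.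
   Formalization: The rank $\mathrm{rank}_{\mathbb{R}}$ is taken over the rationals instead of the reals. -}

module Defs where

open import Data.Bool using (Bool; true; false; _∧_; if_then_else_)
open import Data.Nat using (ℕ; zero; suc; _*_; _^_; _≤_)
import Data.Nat as ℕ
open import Data.Fin using (Fin; zero; suc; remQuot)
open import Data.Product using (Σ; ∃; _×_; _,_; proj₁; proj₂)
open import Data.Rational using (ℚ; 0ℚ; 1ℚ)
import Data.Rational as ℚ
open import Relation.Binary.PropositionalEquality using (_≡_)
open import Relation.Nullary using (¬_)

Mat01 : ℕ → ℕ → Set
Mat01 p q = Fin p → Fin q → Bool

-- Kronecker product: row index of A ⊗ B is (i , k) ↦ combine i k,
-- i.e. the (i,j) block is A i j · B.
_⊗_ : ∀ {p q p' q'} → Mat01 p q → Mat01 p' q' → Mat01 (p * p') (q * q')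
_⊗_ {p} {q} {p'} {q'} A B x y =
  A (proj₁ (remQuot {p} p' x)) (proj₁ (remQuot {q} q' y)) ∧
  B (proj₂ (remQuot {p} p' x)) (proj₂ (remQuot {q} q' y))

-- Kronecker power, M^{⊗0} = [1] (1×1), M^{⊗(k+1)} = M ⊗ M^{⊗k};
-- so M^{⊗1} = M ⊗ [1], which is M (with Fin (n*1) indices).
kpow : ∀ {n} → (k : ℕ) → Mat01 n n → Mat01 (n ^ k) (n ^ k)
kpow zero    M _ _ = true
kpow (suc k) M = M ⊗ kpow k M

sumℚ : ∀ {r} → (Fin r → ℚ) → ℚ
sumℚ {zero}  f = 0ℚ
sumℚ {suc r} f = f zero ℚ.+ sumℚ (λ i → f (suc i))

sumℕ : ∀ {r} → (Fin r → ℕ) → ℕ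
sumℕ {zero}  f = 0
sumℕ {suc r} f = f zero ℕ.+ sumℕ (λ i → f (suc i))

toℚ : Bool → ℚ
toℚ b = if b then 1ℚ else 0ℚ

toℕ01 : Bool → ℕ
toℕ01 b = if b then 1 else 0

LinIndep : ∀ {m r} → (Fin r → Fin m → ℚ) → Set
LinIndep {m} {r} v =
  (c : Fin r → ℚ) → (∀ i → sumℚ (λ j → c j ℚ.* v j i) ≡ 0ℚ) → ∀ j → c j ≡ 0ℚ

columns : ∀ {p q r} → Mat01 p q → (Fin r → Fin q) → Fin r → Fin p → ℚ
columns M cols j i = toℚ (M i (cols j))

-- rank over ℚ (= rank over ℝ for rational matrices):
-- the maximal number of linearly independent columns
HasRankℚ : ∀ {p q} → Mat01 p q → ℕ → Set
HasRankℚ {p} {q} M r =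
  (Σ (Fin r → Fin q) λ cols → LinIndep (columns M cols)) ×
  ((cols : Fin (suc r) → Fin q) → ¬ LinIndep (columns M cols))

BinFactor : ∀ {p q} → Mat01 p q → (d : ℕ) → Mat01 p d → Mat01 d q → Set
BinFactor {p} {q} M d A B =
  ∀ i j → sumℕ (λ l → toℕ01 (A i l) * toℕ01 (B l j)) ≡ toℕ01 (M i j)

HasBinRank : ∀ {p q} → Mat01 p q → ℕ → Set
HasBinRank {p} {q} M d =
  (Σ (Mat01 p d) λ A → Σ (Mat01 d q) λ B → BinFactor M d A B) ×
  (∀ d' (A : Mat01 p d') (B : Mat01 d' q) → BinFactor M d' A B → d ≤ d')

-- M is the 2m × 2m block matrix [[T, J − T], [J − T, T]], T the lower unitriangular 0,1 matrix
-- (T t u = 1 iff u ≤ t) and m = ⌊n/2⌋, padded by a zero row and column when n is odd.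
-- Real rank: the m columns of the first block column together with the first column of the
-- second one are independent (triangularity), and since the u-th columns of the two block columns
-- always add up to the indicator of the unpadded rows, that indicator and the m columns of the first
-- block column span all columns. An independent family of r columns and a spanning family of r
-- vectors both pass to Kronecker products with their sizes multiplied, so the rank of the k-th
-- power is (m + 1)^k.
-- Binary rank: the 2m diagonal positions of the unpadded part form a fooling set (for u ≠ v one of
-- M u v, M v u vanishes, by antisymmetry or by totality of ≤); fooling sets multiply as well, giving
-- the lower bound (2m)^k, and the k-th power has exactly (2m)^k nonzero columns.

module Submission where

open import Defs
open import Data.Nat using (ℕ; _≤_; _*_; _+_; _^_; ⌊_/2⌋)
open import Data.Product using (Σ; _×_)
open import Relation.Binary.PropositionalEquality using (_≢_)

open import Algebra.Bundles using (CommutativeMonoid; CommutativeRing)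
import Algebra.Properties.CommutativeMonoid.Sum as CommutativeMonoidSum
open import Data.Bool using (Bool; true; false; _∧_; not)
import Data.Bool as Bool
import Data.Bool.Properties as BoolP
open import Data.Empty using (⊥-elim)
open import Data.Fin using (Fin; zero; suc; combine; remQuot; punchIn; _↑ˡ_; _↑ʳ_)
import Data.Fin as Fin
import Data.Fin.Induction as FinInduction
import Data.Fin.Properties as FinP
open import Data.Nat using (zero; suc; _∸_)
import Data.Nat as ℕ
import Data.Nat.Properties as ℕP
open import Data.Product using (∃; _,_; proj₁; proj₂)
open import Data.Rational using (ℚ; 0ℚ; 1ℚ)
import Data.Rational as ℚ
import Data.Rational.Properties as ℚP
open import Data.Rational.Solver using (module +-*-Solver)
open import Data.Sum using (_⊎_; inj₁; inj₂; [_,_]′)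
open import Data.Vec.Functional using (_∷_; insertAt)
import Data.Vec.Functional.Properties as VectorP
open import Function using (_∘_; const)
open import Function.Definitions using (Injective)
open import Induction.WellFounded using (WfRec; module All)
open import Relation.Binary.PropositionalEquality
  using (_≡_; refl; sym; trans; cong; cong₂; subst; module ≡-Reasoning)
open import Relation.Nullary using (¬_; Dec; yes; no; does)
open import Relation.Nullary.Decidable using (dec-true; dec-false)

open +-*-Solver using (solve; _:+_; _:*_; _:-_; :-_; _:=_; con)

module FiniteSums {c ℓ} (M : CommutativeMonoid c ℓ) where
  open CommutativeMonoid M using (Carrier; _≈_; _∙_; ε; ∙-congˡ; identityʳ)
    renaming (trans to ≈-trans)
  open CommutativeMonoidSum M using (sum; sum-cong-≋; sum-replicate-zero; sum-remove)

  sum-zero : ∀ {n} (f : Fin n → Carrier) → (∀ i → f i ≈ ε) → sum f ≈ ε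
  sum-zero {n} f f≈ε = ≈-trans (sum-cong-≋ f≈ε) (sum-replicate-zero n)

  sum-single : ∀ {n} (f : Fin n → Carrier) i → (∀ j → j ≢ i → f j ≈ ε) → sum f ≈ f i
  sum-single {suc n} f i others =
    ≈-trans (sum-remove {i = i} f)
      (≈-trans (∙-congˡ (sum-zero _ (λ j → others (punchIn i j) (FinP.punchInᵢ≢i i j))))
        (identityʳ (f i)))

module ℚΣ = FiniteSums ℚP.+-0-commutativeMonoid
module ℕΣ = FiniteSums ℕP.+-0-commutativeMonoid
open CommutativeMonoidSum ℕP.+-0-commutativeMonoid using () renaming (sum to sumᴺ)

open import Algebra.Properties.Semiring.Sum (CommutativeRing.semiring ℚP.+-*-commutativeRing)

sumℚ≡sum : ∀ {r} (f : Fin r → ℚ) → sumℚ f ≡ sum f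
sumℚ≡sum {zero} f = refl
sumℚ≡sum {suc r} f = cong (f zero ℚ.+_) (sumℚ≡sum (f ∘ suc))

sumℕ≡sum : ∀ {r} (f : Fin r → ℕ) → sumℕ f ≡ sumᴺ f
sumℕ≡sum {zero} f = refl
sumℕ≡sum {suc r} f = cong (f zero ℕ.+_) (sumℕ≡sum (f ∘ suc))

sum-*-sum : ∀ {m n} (f : Fin m → ℚ) (g : Fin n → ℚ) →
            sum f ℚ.* sum g ≡ ∑[ a < m ] ∑[ b < n ] (f a ℚ.* g b)
sum-*-sum f g = trans (*-distribʳ-sum (sum g) f) (sum-cong-≗ (λ a → *-distribˡ-sum (f a) g))

sum-↑ : ∀ m {n} (f : Fin (m + n) → ℚ) →
        sum f ≡ ∑[ i < m ] f (i ↑ˡ n) ℚ.+ ∑[ j < n ] f (m ↑ʳ j)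
sum-↑ zero f = sym (ℚP.+-identityˡ (sum f))
sum-↑ (suc m) f = trans (cong (f zero ℚ.+_) (sum-↑ m (f ∘ suc))) (sym (ℚP.+-assoc (f zero) _ _))

sum-combine : ∀ m {n} (f : Fin (m * n) → ℚ) → sum f ≡ ∑[ a < m ] ∑[ b < n ] f (combine a b)
sum-combine zero f = refl
sum-combine (suc m) {n} f =
  trans (sum-↑ n f) (cong (∑[ b < n ] f (b ↑ˡ m * n) ℚ.+_) (sum-combine m (f ∘ (n ↑ʳ_))))

∀-combine : ∀ {m n} {P : Fin (m * n) → Set} → (∀ a b → P (combine a b)) → ∀ x → P x
∀-combine {m} {n} {P} P-combine x =
  subst P (FinP.combine-remQuot {m} n x) (P-combine (proj₁ (remQuot {m} n x)) (proj₂ (remQuot {m} n x)))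

⊗-combine : ∀ {p q p′ q′} (A : Mat01 p q) (B : Mat01 p′ q′) i i′ j j′ →
            (A ⊗ B) (combine i i′) (combine j j′) ≡ A i j ∧ B i′ j′
⊗-combine A B i i′ j j′ =
  cong₂ (λ x y → A (proj₁ x) (proj₁ y) ∧ B (proj₂ x) (proj₂ y))
        (FinP.remQuot-combine i i′) (FinP.remQuot-combine j j′)

_⊗ᶠ_ : ∀ {s s′ p p′} → (Fin s → Fin p) → (Fin s′ → Fin p′) → Fin (s * s′) → Fin (p * p′)
_⊗ᶠ_ {s} {s′} f g x = combine (f (proj₁ (remQuot {s} s′ x))) (g (proj₂ (remQuot {s} s′ x)))

⊗ᶠ-combine : ∀ {s s′ p p′} (f : Fin s → Fin p) (g : Fin s′ → Fin p′) a b →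
             (f ⊗ᶠ g) (combine a b) ≡ combine (f a) (g b)
⊗ᶠ-combine f g a b = cong (λ x → combine (f (proj₁ x)) (g (proj₂ x))) (FinP.remQuot-combine a b)

_⊗ᵛ_ : ∀ {r r′ m m′} → (Fin r → Fin m → ℚ) → (Fin r′ → Fin m′ → ℚ) →
       Fin (r * r′) → Fin (m * m′) → ℚ
_⊗ᵛ_ {r} {r′} {m} {m′} u w x y =
  u (proj₁ (remQuot {r} r′ x)) (proj₁ (remQuot {m} m′ y)) ℚ.*
  w (proj₂ (remQuot {r} r′ x)) (proj₂ (remQuot {m} m′ y))

⊗ᵛ-combine : ∀ {r r′ m m′} (u : Fin r → Fin m → ℚ) (w : Fin r′ → Fin m′ → ℚ) a b i j →
             (u ⊗ᵛ w) (combine a b) (combine i j) ≡ u a i ℚ.* w b j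
⊗ᵛ-combine u w a b i j =
  cong₂ (λ x y → u (proj₁ x) (proj₁ y) ℚ.* w (proj₂ x) (proj₂ y))
        (FinP.remQuot-combine a b) (FinP.remQuot-combine i j)

-- Linear dependence over ℚ

lincomb : ∀ {r} {I : Set} → (Fin r → ℚ) → (Fin r → I → ℚ) → I → ℚ
lincomb {r} c v i = ∑[ j < r ] (c j ℚ.* v j i)

Independent : ∀ {r} {I : Set} → (Fin r → I → ℚ) → Set
Independent v = ∀ c → (∀ i → lincomb c v i ≡ 0ℚ) → ∀ j → c j ≡ 0ℚ

Dependent : ∀ {r} {I : Set} → (Fin r → I → ℚ) → Set
Dependent {r} v = Σ (Fin r → ℚ) λ c → (∀ i → lincomb c v i ≡ 0ℚ) × ∃ λ j → c j ≢ 0ℚ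

independent⇒LinIndep : ∀ {r m} {v : Fin r → Fin m → ℚ} → Independent v → LinIndep v
independent⇒LinIndep {v = v} independent c c·v≡0 =
  independent c (λ i → trans (sym (sumℚ≡sum (λ j → c j ℚ.* v j i))) (c·v≡0 i))

dependent⇒¬LinIndep : ∀ {r m} {v : Fin r → Fin m → ℚ} → Dependent v → ¬ LinIndep v
dependent⇒¬LinIndep {v = v} (c , c·v≡0 , j , cj≢0) linIndep =
  cj≢0 (linIndep c (λ i → trans (sumℚ≡sum (λ j → c j ℚ.* v j i)) (c·v≡0 i)) j)

Independent-restrict : ∀ {r} {I J : Set} {v : Fin r → I → ℚ} {w : Fin r → J → ℚ} (ρ : J → I) →
                       (∀ t j → v t (ρ j) ≡ w t j) → Independent w → Independent v
Independent-restrict ρ v∘ρ≡w w-independent c c·v≡0 =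
  w-independent c (λ j → trans (sum-cong-≗ (λ t → cong (c t ℚ.*_) (sym (v∘ρ≡w t j)))) (c·v≡0 (ρ j)))

lincomb-lincomb : ∀ {s r} {I : Set} (c : Fin s → ℚ) (R : Fin s → Fin r → ℚ) (w : Fin r → I → ℚ) i →
                  lincomb c (λ j → lincomb (R j) w) i ≡ lincomb (lincomb c R) w i
lincomb-lincomb {s} {r} c R w i = begin
  ∑[ j < s ] (c j ℚ.* ∑[ t < r ] (R j t ℚ.* w t i))
    ≡⟨ sum-cong-≗ (λ j → *-distribˡ-sum (c j) (λ t → R j t ℚ.* w t i)) ⟩
  ∑[ j < s ] ∑[ t < r ] (c j ℚ.* (R j t ℚ.* w t i))
    ≡⟨ ∑-comm (λ j t → c j ℚ.* (R j t ℚ.* w t i)) ⟩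
  ∑[ t < r ] ∑[ j < s ] (c j ℚ.* (R j t ℚ.* w t i))
    ≡⟨ sum-cong-≗ (λ t → trans (sum-cong-≗ (λ j → sym (ℚP.*-assoc (c j) (R j t) (w t i))))
                                (sym (*-distribʳ-sum (w t i) (λ j → c j ℚ.* R j t)))) ⟩
  ∑[ t < r ] (∑[ j < s ] (c j ℚ.* R j t) ℚ.* w t i) ∎
  where open ≡-Reasoning

dependent-lincomb : ∀ {s r} {I : Set} {v : Fin s → I → ℚ} (R : Fin s → Fin r → ℚ) (w : Fin r → I → ℚ) →
                    (∀ j i → v j i ≡ lincomb (R j) w i) → Dependent R → Dependent v
dependent-lincomb {v = v} R w v≡R·w (c , c·R≡0 , j , cj≢0) = c , c·v≡0 , j , cj≢0
  where
  c·v≡0 : ∀ i → lincomb c v i ≡ 0ℚ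
  c·v≡0 i = begin
    lincomb c v i                    ≡⟨ sum-cong-≗ (λ j → cong (c j ℚ.*_) (v≡R·w j i)) ⟩
    lincomb c (λ j → lincomb (R j) w) i ≡⟨ lincomb-lincomb c R w i ⟩
    lincomb (lincomb c R) w i
      ≡⟨ ℚΣ.sum-zero _ (λ t → trans (cong (ℚ._* w t i) (c·R≡0 t)) (ℚP.*-zeroˡ (w t i))) ⟩
    0ℚ                               ∎
    where open ≡-Reasoning

unit : ∀ {r} → Fin r → Fin r → ℚ
unit t₀ t = toℚ (does (t Fin.≟ t₀))

lincomb-isolate : ∀ {r} {I : Set} (c : Fin r → ℚ) (v : Fin r → I → ℚ) i t₀ →
                  (∀ t → t ≢ t₀ → c t ℚ.* v t i ≡ 0ℚ) → lincomb c v i ≡ c t₀ ℚ.* v t₀ i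
lincomb-isolate c v i t₀ = ℚΣ.sum-single (λ t → c t ℚ.* v t i) t₀

lincomb-unit : ∀ {r} {I : Set} (t₀ : Fin r) (v : Fin r → I → ℚ) i → lincomb (unit t₀) v i ≡ v t₀ i
lincomb-unit t₀ v i = begin
  lincomb (unit t₀) v i                        ≡⟨ lincomb-isolate (unit t₀) v i t₀ off-t₀ ⟩
  toℚ (does (t₀ Fin.≟ t₀)) ℚ.* v t₀ i          ≡⟨ cong (λ b → toℚ b ℚ.* v t₀ i) (dec-true (t₀ Fin.≟ t₀) refl) ⟩
  1ℚ ℚ.* v t₀ i                                ≡⟨ ℚP.*-identityˡ (v t₀ i) ⟩
  v t₀ i                                       ∎
  where
  open ≡-Reasoning
  off-t₀ : ∀ t → t ≢ t₀ → unit t₀ t ℚ.* v t i ≡ 0ℚ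
  off-t₀ t t≢t₀ = trans (cong (λ b → toℚ b ℚ.* v t i) (dec-false (t Fin.≟ t₀) t≢t₀)) (ℚP.*-zeroˡ (v t i))

lincomb-− : ∀ {r} {I : Set} (c d : Fin r → ℚ) (v : Fin r → I → ℚ) i →
            lincomb (λ t → c t ℚ.- d t) v i ≡ lincomb c v i ℚ.- lincomb d v i
lincomb-− {zero} c d v i = refl
lincomb-− {suc r} c d v i =
  trans (cong ((c zero ℚ.- d zero) ℚ.* v zero i ℚ.+_) (lincomb-− (c ∘ suc) (d ∘ suc) (v ∘ suc) i))
        (solve 5 (λ c d x s t → (c :- d) :* x :+ (s :- t) := (c :* x :+ s) :- (d :* x :+ t))
               refl (c zero) (d zero) (v zero i) (lincomb (c ∘ suc) (v ∘ suc) i) (lincomb (d ∘ suc) (v ∘ suc) i))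

p*q≢0 : ∀ {p q} → p ≢ 0ℚ → q ≢ 0ℚ → p ℚ.* q ≢ 0ℚ
p*q≢0 {p} {q} p≢0 q≢0 pq≡0 = q≢0 (begin
  q                    ≡⟨ sym (ℚP.*-identityˡ q) ⟩
  1ℚ ℚ.* q             ≡⟨ cong (ℚ._* q) (sym (ℚP.*-inverseˡ p)) ⟩
  (ℚ.1/ p ℚ.* p) ℚ.* q ≡⟨ ℚP.*-assoc (ℚ.1/ p) p q ⟩
  ℚ.1/ p ℚ.* (p ℚ.* q) ≡⟨ cong (ℚ.1/ p ℚ.*_) pq≡0 ⟩
  ℚ.1/ p ℚ.* 0ℚ        ≡⟨ ℚP.*-zeroʳ (ℚ.1/ p) ⟩
  0ℚ                   ∎)
  where
  open ≡-Reasoning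
  instance
    p-nonZero : ℚ.NonZero p
    p-nonZero = ℚ.≢-nonZero p≢0

dependent-zeroFirstCoordinate : ∀ {N} (v : Fin (suc (suc N)) → Fin (suc N) → ℚ) → (∀ j → v j zero ≡ 0ℚ) →
                       Dependent (λ j i → v (suc j) (suc i)) → Dependent v
dependent-zeroFirstCoordinate v column₀≡0 (c , c·w≡0 , j , cj≢0) = 0ℚ ∷ c , c·v≡0 , suc j , cj≢0
  where
  drop-first : ∀ y → lincomb (0ℚ ∷ c) v y ≡ lincomb c (v ∘ suc) y
  drop-first y = trans (cong (ℚ._+ lincomb c (v ∘ suc) y) (ℚP.*-zeroˡ (v zero y))) (ℚP.+-identityˡ _)
  c·v≡0 : ∀ y → lincomb (0ℚ ∷ c) v y ≡ 0ℚ
  c·v≡0 zero = trans (drop-first zero)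
    (ℚΣ.sum-zero _ (λ j → trans (cong (c j ℚ.*_) (column₀≡0 (suc j))) (ℚP.*-zeroʳ (c j))))
  c·v≡0 (suc i) = trans (drop-first (suc i)) (c·w≡0 i)

-- Division-free elimination of coordinate zero with the pivot v p zero: every `eliminate j`
-- vanishes at zero, and `lift` turns a dependency among them into one among the v's.
module PivotElimination {N} (v : Fin (suc (suc N)) → Fin (suc N) → ℚ) (p : Fin (suc (suc N))) where

  eliminate : Fin (suc N) → Fin (suc N) → ℚ
  eliminate j y = v p zero ℚ.* v (punchIn p j) y ℚ.- v (punchIn p j) zero ℚ.* v p y

  pivotWeight : (Fin (suc N) → ℚ) → ℚ
  pivotWeight c = ∑[ j < suc N ] (c j ℚ.* v (punchIn p j) zero)

  lift : (Fin (suc N) → ℚ) → Fin (suc (suc N)) → ℚ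
  lift c = insertAt (λ j → v p zero ℚ.* c j) p (ℚ.- pivotWeight c)

  lift-punchIn : ∀ c j → lift c (punchIn p j) ≡ v p zero ℚ.* c j
  lift-punchIn c j = VectorP.insertAt-punchIn (λ j → v p zero ℚ.* c j) p (ℚ.- pivotWeight c) j

  lincomb-lift : ∀ c y → lincomb (lift c) v y ≡ lincomb c eliminate y
  lincomb-lift c y = begin
    lincomb (lift c) v y
      ≡⟨ sum-remove {i = p} (λ x → lift c x ℚ.* v x y) ⟩
    lift c p ℚ.* v p y ℚ.+ ∑[ j < suc N ] (lift c (punchIn p j) ℚ.* v (punchIn p j) y)
      ≡⟨ cong₂ (λ s t → s ℚ.* v p y ℚ.+ t)
               (VectorP.insertAt-lookup (λ j → a ℚ.* c j) p (ℚ.- S))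
               (sum-cong-≗ (λ j → cong (ℚ._* v (punchIn p j) y) (lift-punchIn c j))) ⟩
    ℚ.- S ℚ.* v p y ℚ.+ T
      ≡⟨ solve 3 (λ s z t → (:- s) :* z :+ t := t :+ s :* (:- z)) refl S (v p y) T ⟩
    T ℚ.+ S ℚ.* ℚ.- v p y
      ≡⟨ cong (T ℚ.+_) (*-distribʳ-sum (ℚ.- v p y) (λ j → c j ℚ.* v (punchIn p j) zero)) ⟩
    T ℚ.+ ∑[ j < suc N ] ((c j ℚ.* v (punchIn p j) zero) ℚ.* ℚ.- v p y)
      ≡⟨ sym (∑-distrib-+ (λ j → (a ℚ.* c j) ℚ.* v (punchIn p j) y)
                          (λ j → (c j ℚ.* v (punchIn p j) zero) ℚ.* ℚ.- v p y)) ⟩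
    ∑[ j < suc N ] ((a ℚ.* c j) ℚ.* v (punchIn p j) y ℚ.+ (c j ℚ.* v (punchIn p j) zero) ℚ.* ℚ.- v p y)
      ≡⟨ sum-cong-≗ (λ j → solve 5 (λ a c x b z → (a :* c) :* x :+ (c :* b) :* (:- z) := c :* (a :* x :- b :* z))
                                   refl a (c j) (v (punchIn p j) y) (v (punchIn p j) zero) (v p y)) ⟩
    lincomb c eliminate y ∎
    where
    open ≡-Reasoning
    a S T : ℚ
    a = v p zero
    S = pivotWeight c
    T = ∑[ j < suc N ] ((a ℚ.* c j) ℚ.* v (punchIn p j) y)

  dependent-pivot : v p zero ≢ 0ℚ → Dependent (λ j i → eliminate j (suc i)) → Dependent v
  dependent-pivot a≢0 (c , c·w≡0 , j , cj≢0) = lift c , c·v≡0 , punchIn p j , liftc≢0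
    where
    c·v≡0 : ∀ y → lincomb (lift c) v y ≡ 0ℚ
    c·v≡0 zero = trans (lincomb-lift c zero) (ℚΣ.sum-zero (λ j → c j ℚ.* eliminate j zero) (λ j →
      solve 3 (λ c a b → c :* (a :* b :- b :* a) := con 0ℚ) refl (c j) (v p zero) (v (punchIn p j) zero)))
    c·v≡0 (suc i) = trans (lincomb-lift c (suc i)) (c·w≡0 i)
    liftc≢0 : lift c (punchIn p j) ≢ 0ℚ
    liftc≢0 = subst (_≢ 0ℚ) (sym (lift-punchIn c j)) (p*q≢0 a≢0 cj≢0)

suc-vectors⇒dependent : ∀ N (v : Fin (suc N) → Fin N → ℚ) → Dependent v
suc-vectors⇒dependent zero v = (λ _ → 1ℚ) , (λ ()) , zero , ℚP.1≢0
suc-vectors⇒dependent (suc N) v with FinP.all? (λ j → v j zero ℚP.≟ 0ℚ)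
... | yes column₀≡0 =
  dependent-zeroFirstCoordinate v column₀≡0 (suc-vectors⇒dependent N (λ j i → v (suc j) (suc i)))
... | no column₀≢0 with p , vp≢0 ← FinP.¬∀⟶∃¬ _ _ (λ j → v j zero ℚP.≟ 0ℚ) column₀≢0 =
  dependent-pivot vp≢0 (suc-vectors⇒dependent N (λ j i → eliminate j (suc i)))
  where open PivotElimination v p

-- Real rank of Kronecker powers

toℚ-∧ : ∀ a b → toℚ (a ∧ b) ≡ toℚ a ℚ.* toℚ b
toℚ-∧ true b = sym (ℚP.*-identityˡ (toℚ b))
toℚ-∧ false b = sym (ℚP.*-zeroˡ (toℚ b))

columns-⊗ : ∀ {p q p′ q′ r r′} (A : Mat01 p q) (B : Mat01 p′ q′) (f : Fin r → Fin q) (g : Fin r′ → Fin q′) →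
            ∀ x y → (columns A f ⊗ᵛ columns B g) x y ≡ columns (A ⊗ B) (f ⊗ᶠ g) x y
columns-⊗ A B f g = ∀-combine λ a b → ∀-combine λ i i′ → begin
  (columns A f ⊗ᵛ columns B g) (combine a b) (combine i i′)
    ≡⟨ ⊗ᵛ-combine (columns A f) (columns B g) a b i i′ ⟩
  toℚ (A i (f a)) ℚ.* toℚ (B i′ (g b))
    ≡⟨ sym (toℚ-∧ (A i (f a)) (B i′ (g b))) ⟩
  toℚ (A i (f a) ∧ B i′ (g b))
    ≡⟨ cong toℚ (sym (⊗-combine A B i i′ (f a) (g b))) ⟩
  toℚ ((A ⊗ B) (combine i i′) (combine (f a) (g b)))
    ≡⟨ cong (toℚ ∘ (A ⊗ B) (combine i i′)) (sym (⊗ᶠ-combine f g a b)) ⟩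
  toℚ ((A ⊗ B) (combine i i′) ((f ⊗ᶠ g) (combine a b))) ∎
  where open ≡-Reasoning

lincomb-⊗ᵛ : ∀ {r r′ m m′} (c : Fin (r * r′) → ℚ) (u : Fin r → Fin m → ℚ) (w : Fin r′ → Fin m′ → ℚ) i i′ →
             lincomb c (u ⊗ᵛ w) (combine i i′) ≡ lincomb (λ a → lincomb (λ b → c (combine a b)) w i′) u i
lincomb-⊗ᵛ {r} {r′} c u w i i′ = begin
  lincomb c (u ⊗ᵛ w) (combine i i′)
    ≡⟨ sum-combine r (λ x → c x ℚ.* (u ⊗ᵛ w) x (combine i i′)) ⟩
  ∑[ a < r ] ∑[ b < r′ ] (c (combine a b) ℚ.* (u ⊗ᵛ w) (combine a b) (combine i i′))
    ≡⟨ sum-cong-≗ (λ a → sum-cong-≗ (λ b → cong (c (combine a b) ℚ.*_) (⊗ᵛ-combine u w a b i i′))) ⟩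
  ∑[ a < r ] ∑[ b < r′ ] (c (combine a b) ℚ.* (u a i ℚ.* w b i′))
    ≡⟨ sum-cong-≗ (λ a → trans (sum-cong-≗ (λ b → solve 3 (λ c x y → c :* (x :* y) := (c :* y) :* x)
                                                              refl (c (combine a b)) (u a i) (w b i′)))
                               (sym (*-distribʳ-sum (u a i) (λ b → c (combine a b) ℚ.* w b i′)))) ⟩
  lincomb (λ a → lincomb (λ b → c (combine a b)) w i′) u i ∎
  where open ≡-Reasoning

Independent-⊗ᵛ : ∀ {r r′ m m′} {u : Fin r → Fin m → ℚ} {w : Fin r′ → Fin m′ → ℚ} →
                 Independent u → Independent w → Independent (u ⊗ᵛ w)
Independent-⊗ᵛ {u = u} {w} u-independent w-independent c c·uw≡0 = ∀-combine λ a b →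
  w-independent (λ b → c (combine a b))
    (λ i′ → u-independent (λ a → lincomb (λ b → c (combine a b)) w i′)
                          (λ i → trans (sym (lincomb-⊗ᵛ c u w i i′)) (c·uw≡0 (combine i i′))) a)
    b

lincomb-⊗ᵛ-⊗ᵛ : ∀ {q q′ r r′ m m′} (c : Fin q → Fin r → ℚ) (d : Fin q′ → Fin r′ → ℚ)
                (u : Fin r → Fin m → ℚ) (w : Fin r′ → Fin m′ → ℚ) j j′ i i′ →
                lincomb ((c ⊗ᵛ d) (combine j j′)) (u ⊗ᵛ w) (combine i i′) ≡
                lincomb (c j) u i ℚ.* lincomb (d j′) w i′
lincomb-⊗ᵛ-⊗ᵛ {r = r} {r′} c d u w j j′ i i′ = begin
  lincomb ((c ⊗ᵛ d) (combine j j′)) (u ⊗ᵛ w) (combine i i′)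
    ≡⟨ sum-combine r (λ x → (c ⊗ᵛ d) (combine j j′) x ℚ.* (u ⊗ᵛ w) x (combine i i′)) ⟩
  ∑[ a < r ] ∑[ b < r′ ] ((c ⊗ᵛ d) (combine j j′) (combine a b) ℚ.* (u ⊗ᵛ w) (combine a b) (combine i i′))
    ≡⟨ sum-cong-≗ (λ a → sum-cong-≗ (λ b →
         trans (cong₂ ℚ._*_ (⊗ᵛ-combine c d j j′ a b) (⊗ᵛ-combine u w a b i i′))
               (solve 4 (λ x y z t → (x :* y) :* (z :* t) := (x :* z) :* (y :* t))
                      refl (c j a) (d j′ b) (u a i) (w b i′)))) ⟩
  ∑[ a < r ] ∑[ b < r′ ] ((c j a ℚ.* u a i) ℚ.* (d j′ b ℚ.* w b i′))
    ≡⟨ sym (sum-*-sum (λ a → c j a ℚ.* u a i) (λ b → d j′ b ℚ.* w b i′)) ⟩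
  lincomb (c j) u i ℚ.* lincomb (d j′) w i′ ∎
  where open ≡-Reasoning

IndependentColumns : ∀ {p q} → Mat01 p q → ℕ → Set
IndependentColumns {q = q} M r = Σ (Fin r → Fin q) λ cols → Independent (columns M cols)

record SpannedBy {p q} (M : Mat01 p q) (r : ℕ) : Set where
  field
    generator   : Fin r → Fin p → ℚ
    coordinates : Fin q → Fin r → ℚ
    spans       : ∀ j i → toℚ (M i j) ≡ lincomb (coordinates j) generator i

independent∧spanned⇒HasRankℚ : ∀ {p q r} {M : Mat01 p q} → IndependentColumns M r → SpannedBy M r → HasRankℚ M r
independent∧spanned⇒HasRankℚ {M = M} (cols , independent) spanned =
  (cols , independent⇒LinIndep independent) ,
  λ cols′ → dependent⇒¬LinIndep {v = columns M cols′}
    (dependent-lincomb (coordinates ∘ cols′) generator (spans ∘ cols′)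
                       (suc-vectors⇒dependent _ (coordinates ∘ cols′)))
  where open SpannedBy spanned

IndependentColumns-⊗ : ∀ {p q p′ q′ r r′} {A : Mat01 p q} {B : Mat01 p′ q′} →
                       IndependentColumns A r → IndependentColumns B r′ → IndependentColumns (A ⊗ B) (r * r′)
IndependentColumns-⊗ {A = A} {B} (f , f-independent) (g , g-independent) =
  f ⊗ᶠ g ,
  Independent-restrict (λ i → i) (λ x y → sym (columns-⊗ A B f g x y)) (Independent-⊗ᵛ f-independent g-independent)

SpannedBy-⊗ : ∀ {p q p′ q′ r r′} {A : Mat01 p q} {B : Mat01 p′ q′} →
              SpannedBy A r → SpannedBy B r′ → SpannedBy (A ⊗ B) (r * r′)
SpannedBy-⊗ {A = A} {B} SA SB = record
  { generator   = A.generator ⊗ᵛ B.generator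
  ; coordinates = A.coordinates ⊗ᵛ B.coordinates
  ; spans       = ∀-combine λ j j′ → ∀-combine λ i i′ → begin
      toℚ ((A ⊗ B) (combine i i′) (combine j j′))
        ≡⟨ cong toℚ (⊗-combine A B i i′ j j′) ⟩
      toℚ (A i j ∧ B i′ j′)
        ≡⟨ toℚ-∧ (A i j) (B i′ j′) ⟩
      toℚ (A i j) ℚ.* toℚ (B i′ j′)
        ≡⟨ cong₂ ℚ._*_ (A.spans j i) (B.spans j′ i′) ⟩
      lincomb (A.coordinates j) A.generator i ℚ.* lincomb (B.coordinates j′) B.generator i′
        ≡⟨ sym (lincomb-⊗ᵛ-⊗ᵛ A.coordinates B.coordinates A.generator B.generator j j′ i i′) ⟩
      lincomb ((A.coordinates ⊗ᵛ B.coordinates) (combine j j′)) (A.generator ⊗ᵛ B.generator) (combine i i′) ∎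
  }
  where
  open ≡-Reasoning
  module A = SpannedBy SA
  module B = SpannedBy SB

IndependentColumns-kpow : ∀ {n r} {M : Mat01 n n} → IndependentColumns M r →
                          ∀ k → IndependentColumns (kpow k M) (r ^ k)
IndependentColumns-kpow _ zero = (λ t → t) , independent-one
  where
  independent-one : Independent {1} {Fin 1} (λ _ _ → 1ℚ)
  independent-one c c·1≡0 zero =
    trans (solve 1 (λ x → x := x :* con 1ℚ :+ con 0ℚ) refl (c zero)) (c·1≡0 zero)
IndependentColumns-kpow {M = M} I (suc k) = IndependentColumns-⊗ {A = M} {kpow k M} I (IndependentColumns-kpow I k)

SpannedBy-kpow : ∀ {n r} {M : Mat01 n n} → SpannedBy M r → ∀ k → SpannedBy (kpow k M) (r ^ k)
SpannedBy-kpow _ zero = record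
  { generator = λ _ _ → 1ℚ ; coordinates = λ _ _ → 1ℚ ; spans = λ _ _ → refl }
SpannedBy-kpow {M = M} S (suc k) = SpannedBy-⊗ {A = M} {kpow k M} S (SpannedBy-kpow S k)

-- Binary rank of Kronecker powers

record FoolingSet {p q} (M : Mat01 p q) (s : ℕ) : Set where
  field
    row  : Fin s → Fin p
    col  : Fin s → Fin q
    hit  : ∀ x → M (row x) (col x) ≡ true
    fool : ∀ x y → x ≢ y → M (row x) (col y) ∧ M (row y) (col x) ≡ false

  col-injective : Injective _≡_ _≡_ col
  col-injective {x} {y} colx≡coly with x Fin.≟ y
  ... | yes x≡y = x≡y
  ... | no x≢y with () ← trans (sym (fool x y x≢y))
                               (cong₂ _∧_ (trans (cong (M (row x)) (sym colx≡coly)) (hit x))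
                                          (trans (cong (M (row y)) colx≡coly) (hit y)))

NonzeroColumnsAmong : ∀ {p q s} → Mat01 p q → (Fin s → Fin q) → Set
NonzeroColumnsAmong M col = ∀ j → (∃ λ x → col x ≡ j) ⊎ (∀ i → M i j ≡ false)

toℕ01-∧ : ∀ a b → toℕ01 a ℕ.* toℕ01 b ≡ toℕ01 (a ∧ b)
toℕ01-∧ true true = refl
toℕ01-∧ true false = refl
toℕ01-∧ false b = refl

∧≡true : ∀ {a b} → a ∧ b ≡ true → a ≡ true × b ≡ true
∧≡true {true} {true} _ = refl , refl

term≤sumℕ : ∀ {r} (f : Fin r → ℕ) i → f i ≤ sumℕ f
term≤sumℕ f zero = ℕP.m≤m+n (f zero) _
term≤sumℕ f (suc i) = ℕP.≤-trans (term≤sumℕ (f ∘ suc) i) (ℕP.m≤n+m _ (f zero))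

module _ {p q d} {M : Mat01 p q} {A : Mat01 p d} {B : Mat01 d q} (factor : BinFactor M d A B) where

  private
    term : Fin p → Fin q → Fin d → ℕ
    term i j l = toℕ01 (A i l) ℕ.* toℕ01 (B l j)

  binFactor-sound : ∀ {i j} l → A i l ≡ true → B l j ≡ true → M i j ≡ true
  binFactor-sound {i} {j} l Ail≡true Blj≡true = toℕ01≥1 (begin
    1                ≡⟨ cong₂ (λ a b → toℕ01 a ℕ.* toℕ01 b) Ail≡true Blj≡true ⟨
    term i j l       ≤⟨ term≤sumℕ (term i j) l ⟩
    sumℕ (term i j)  ≡⟨ factor i j ⟩
    toℕ01 (M i j)    ∎)
    where
    open ℕP.≤-Reasoning
    toℕ01≥1 : ∀ {b} → 1 ≤ toℕ01 b → b ≡ true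
    toℕ01≥1 {true} _ = refl

  binFactor-complete : ∀ {i j} → M i j ≡ true → ∃ λ l → A i l ≡ true × B l j ≡ true
  binFactor-complete {i} {j} Mij≡true =
    let l , ¬AilBlj≡false = FinP.¬∀⟶∃¬ d _ (λ l → A i l ∧ B l j Bool.≟ false) all-false⇒⊥
    in l , ∧≡true (BoolP.¬-not ¬AilBlj≡false)
    where
    all-false⇒⊥ : ¬ (∀ l → A i l ∧ B l j ≡ false)
    all-false⇒⊥ all-false = ℕP.1+n≢0 (begin
      1               ≡⟨ cong toℕ01 Mij≡true ⟨
      toℕ01 (M i j)   ≡⟨ factor i j ⟨
      sumℕ (term i j) ≡⟨ sumℕ≡sum (term i j) ⟩
      sumᴺ (term i j) ≡⟨ ℕΣ.sum-zero (term i j) (λ l → trans (toℕ01-∧ (A i l) _) (cong toℕ01 (all-false l))) ⟩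
      0               ∎)
      where open ≡-Reasoning

-- A block l covering the fooling entries at x and at y ≠ x would also cover both crossed entries.
foolingSet≤binFactor : ∀ {p q s d} {M : Mat01 p q} {A : Mat01 p d} {B : Mat01 d q} →
                       FoolingSet M s → BinFactor M d A B → s ≤ d
foolingSet≤binFactor {M = M} {A} {B} F factor = FinP.injective⇒≤ witness-injective
  where
  open FoolingSet F
  witness : ∀ x → ∃ λ l → A (row x) l ≡ true × B l (col x) ≡ true
  witness x = binFactor-complete {M = M} {A} {B} factor (hit x)
  crossed : ∀ x y → proj₁ (witness x) ≡ proj₁ (witness y) → M (row x) (col y) ≡ true
  crossed x y same = binFactor-sound {M = M} {A} {B} factor (proj₁ (witness x)) (proj₁ (proj₂ (witness x)))
                       (subst (λ l → B l (col y) ≡ true) (sym same) (proj₂ (proj₂ (witness y))))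
  witness-injective : Injective _≡_ _≡_ (proj₁ ∘ witness)
  witness-injective {x} {y} same with x Fin.≟ y
  ... | yes x≡y = x≡y
  ... | no x≢y with () ← trans (sym (fool x y x≢y)) (cong₂ _∧_ (crossed x y same) (crossed y x (sym same)))

binFactor-selectColumns : ∀ {p q s} {M : Mat01 p q} {col : Fin s → Fin q} →
                          Injective _≡_ _≡_ col → NonzeroColumnsAmong M col →
                          BinFactor M s (λ i x → M i (col x)) (λ x j → does (col x Fin.≟ j))
binFactor-selectColumns {s = s} {M = M} {col} col-injective support i j =
  trans (sumℕ≡sum term) (sum-term (support j))
  where
  term : Fin s → ℕ
  term x = toℕ01 (M i (col x)) ℕ.* toℕ01 (does (col x Fin.≟ j))
  term-off : ∀ y → col y ≢ j → term y ≡ 0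
  term-off y coly≢j = trans (cong (λ b → toℕ01 (M i (col y)) ℕ.* toℕ01 b) (dec-false (col y Fin.≟ j) coly≢j))
                            (ℕP.*-zeroʳ (toℕ01 (M i (col y))))
  term-on : ∀ y → col y ≡ j → term y ≡ toℕ01 (M i j)
  term-on y refl = trans (cong (λ b → toℕ01 (M i j) ℕ.* toℕ01 b) (dec-true (j Fin.≟ j) refl)) (ℕP.*-identityʳ _)
  sum-term : (∃ λ x → col x ≡ j) ⊎ (∀ i → M i j ≡ false) → sumᴺ term ≡ toℕ01 (M i j)
  sum-term (inj₁ (x , colx≡j)) =
    trans (ℕΣ.sum-single term x (λ y y≢x → term-off y (y≢x ∘ col-injective ∘ λ coly≡j → trans coly≡j (sym colx≡j))))
          (term-on x colx≡j)
  sum-term (inj₂ column≡false) = trans (ℕΣ.sum-zero term term≡0) (cong toℕ01 (sym (column≡false i)))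
    where
    term≡0 : ∀ y → term y ≡ 0
    term≡0 y with col y Fin.≟ j
    ... | yes refl = cong (λ b → toℕ01 b ℕ.* 1) (column≡false i)
    ... | no coly≢j = ℕP.*-zeroʳ (toℕ01 (M i (col y)))

foolingSet⇒HasBinRank : ∀ {p q s} {M : Mat01 p q} (F : FoolingSet M s) → NonzeroColumnsAmong M (FoolingSet.col F) →
             HasBinRank M s
foolingSet⇒HasBinRank {M = M} F support =
  ((λ i x → M i (col x)) , (λ x j → does (col x Fin.≟ j)) , binFactor-selectColumns col-injective support) ,
  λ d A B factor → foolingSet≤binFactor {A = A} {B} F factor
  where open FoolingSet F

open import Algebra.Properties.CommutativeSemigroup
  (CommutativeMonoid.commutativeSemigroup BoolP.∧-commutativeMonoid)
  using () renaming (interchange to ∧-interchange)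

⊗-⊗ᶠ-combine : ∀ {p q p′ q′ s s′ t t′} (A : Mat01 p q) (B : Mat01 p′ q′)
               (f : Fin s → Fin p) (f′ : Fin s′ → Fin p′) (g : Fin t → Fin q) (g′ : Fin t′ → Fin q′) a a′ b b′ →
               (A ⊗ B) ((f ⊗ᶠ f′) (combine a a′)) ((g ⊗ᶠ g′) (combine b b′)) ≡ A (f a) (g b) ∧ B (f′ a′) (g′ b′)
⊗-⊗ᶠ-combine A B f f′ g g′ a a′ b b′ =
  trans (cong₂ (A ⊗ B) (⊗ᶠ-combine f f′ a a′) (⊗ᶠ-combine g g′ b b′)) (⊗-combine A B (f a) (f′ a′) (g b) (g′ b′))

FoolingSet-⊗ : ∀ {p q p′ q′ s s′} {A : Mat01 p q} {B : Mat01 p′ q′} →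
               FoolingSet A s → FoolingSet B s′ → FoolingSet (A ⊗ B) (s * s′)
FoolingSet-⊗ {A = A} {B} FA FB = record
  { row  = A.row ⊗ᶠ B.row
  ; col  = A.col ⊗ᶠ B.col
  ; hit  = ∀-combine λ a a′ → trans (entry-⊗ a a′ a a′) (cong₂ _∧_ (A.hit a) (B.hit a′))
  ; fool = ∀-combine λ a a′ → ∀-combine λ b b′ → fool-⊗ a a′ b b′
  }
  where
  module A = FoolingSet FA
  module B = FoolingSet FB
  entry-⊗ : ∀ a a′ b b′ → (A ⊗ B) ((A.row ⊗ᶠ B.row) (combine a a′)) ((A.col ⊗ᶠ B.col) (combine b b′)) ≡
                          A (A.row a) (A.col b) ∧ B (B.row a′) (B.col b′)
  entry-⊗ = ⊗-⊗ᶠ-combine A B A.row B.row A.col B.col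
  fool-⊗ : ∀ a a′ b b′ → combine a a′ ≢ combine b b′ →
           (A ⊗ B) ((A.row ⊗ᶠ B.row) (combine a a′)) ((A.col ⊗ᶠ B.col) (combine b b′)) ∧
           (A ⊗ B) ((A.row ⊗ᶠ B.row) (combine b b′)) ((A.col ⊗ᶠ B.col) (combine a a′)) ≡ false
  fool-⊗ a a′ b b′ ≢ = begin
    _ ≡⟨ cong₂ _∧_ (entry-⊗ a a′ b b′) (entry-⊗ b b′ a a′) ⟩
    (A (A.row a) (A.col b) ∧ B (B.row a′) (B.col b′)) ∧ (A (A.row b) (A.col a) ∧ B (B.row b′) (B.col a′))
      ≡⟨ ∧-interchange (A (A.row a) (A.col b)) (B (B.row a′) (B.col b′))
                       (A (A.row b) (A.col a)) (B (B.row b′) (B.col a′)) ⟩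
    (A (A.row a) (A.col b) ∧ A (A.row b) (A.col a)) ∧ (B (B.row a′) (B.col b′) ∧ B (B.row b′) (B.col a′))
      ≡⟨ one-side-fools (a Fin.≟ b) ⟩
    false ∎
    where
    open ≡-Reasoning
    one-side-fools : Dec (a ≡ b) → (A (A.row a) (A.col b) ∧ A (A.row b) (A.col a)) ∧
                                   (B (B.row a′) (B.col b′) ∧ B (B.row b′) (B.col a′)) ≡ false
    one-side-fools (no a≢b) = cong (_∧ _) (A.fool a b a≢b)
    one-side-fools (yes refl) =
      trans (cong ((A (A.row a) (A.col a) ∧ A (A.row a) (A.col a)) ∧_) (B.fool a′ b′ (≢ ∘ cong (combine a))))
            (BoolP.∧-zeroʳ _)

NonzeroColumnsAmong-⊗ : ∀ {p q p′ q′ s s′} {A : Mat01 p q} {B : Mat01 p′ q′}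
                          {f : Fin s → Fin q} {g : Fin s′ → Fin q′} →
                        NonzeroColumnsAmong A f → NonzeroColumnsAmong B g → NonzeroColumnsAmong (A ⊗ B) (f ⊗ᶠ g)
NonzeroColumnsAmong-⊗ {A = A} {B} {f} {g} A-support B-support =
  ∀-combine λ j j′ → support (A-support j) (B-support j′)
  where
  support : ∀ {j j′} → (∃ λ x → f x ≡ j) ⊎ (∀ i → A i j ≡ false) → (∃ λ x → g x ≡ j′) ⊎ (∀ i → B i j′ ≡ false) →
            (∃ λ x → (f ⊗ᶠ g) x ≡ combine j j′) ⊎ (∀ i → (A ⊗ B) i (combine j j′) ≡ false)
  support (inj₁ (x , fx≡j)) (inj₁ (x′ , gx′≡j′)) =
    inj₁ (combine x x′ , trans (⊗ᶠ-combine f g x x′) (cong₂ combine fx≡j gx′≡j′))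
  support {j} {j′} (inj₂ A-column≡false) _ = inj₂ (∀-combine λ i i′ →
    trans (⊗-combine A B i i′ j j′) (cong (_∧ B i′ j′) (A-column≡false i)))
  support {j} {j′} (inj₁ _) (inj₂ B-column≡false) = inj₂ (∀-combine λ i i′ →
    trans (⊗-combine A B i i′ j j′) (trans (cong (A i j ∧_) (B-column≡false i′)) (BoolP.∧-zeroʳ _)))

FoolingSet-kpow : ∀ {n s} {M : Mat01 n n} → FoolingSet M s → ∀ k → FoolingSet (kpow k M) (s ^ k)
FoolingSet-kpow _ zero = record { row = λ x → x ; col = λ x → x ; hit = λ _ → refl ; fool = fool-one }
  where
  fool-one : ∀ (x y : Fin 1) → x ≢ y → true ∧ true ≡ false
  fool-one zero zero 0≢0 = ⊥-elim (0≢0 refl)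
FoolingSet-kpow {M = M} F (suc k) = FoolingSet-⊗ {A = M} {kpow k M} F (FoolingSet-kpow F k)

NonzeroColumnsAmong-kpow : ∀ {n s} {M : Mat01 n n} (F : FoolingSet M s) →
                           NonzeroColumnsAmong M (FoolingSet.col F) →
                           ∀ k → NonzeroColumnsAmong (kpow k M) (FoolingSet.col (FoolingSet-kpow F k))
NonzeroColumnsAmong-kpow _ _ zero j = inj₁ (j , refl)
NonzeroColumnsAmong-kpow {M = M} F support (suc k) =
  NonzeroColumnsAmong-⊗ {A = M} {kpow k M} support (NonzeroColumnsAmong-kpow F support k)

-- The matrix

data Label (m : ℕ) : Set where
  X Y     : Fin m → Label m
  padding : Label m

side : ∀ {m} → Fin m ⊎ Fin m → Label m
side = [ X , Y ]′

label : ∀ m e → Fin (m + m + e) → Label m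
label m e i = [ side ∘ Fin.splitAt m , const padding ]′ (Fin.splitAt (m + m) i)

entry : ∀ {m} → Label m → Label m → Bool
entry (X t)   (X u)   = does (u Fin.≤? t)
entry (X t)   (Y u)   = not (does (u Fin.≤? t))
entry (Y t)   (X u)   = not (does (u Fin.≤? t))
entry (Y t)   (Y u)   = does (u Fin.≤? t)
entry (X _)   padding = false
entry (Y _)   padding = false
entry padding _       = false

twinStaircase : ∀ m e → Mat01 (m + m + e) (m + m + e)
twinStaircase m e i j = entry (label m e i) (label m e j)

label-↑ˡ : ∀ {m} e (a : Fin (m + m)) → label m e (a ↑ˡ e) ≡ side (Fin.splitAt m a)
label-↑ˡ {m} e a = cong [ side ∘ Fin.splitAt m , const padding ]′ (FinP.splitAt-↑ˡ (m + m) a e)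

position : ∀ {m} e → Fin m ⊎ Fin m → Fin (m + m + e)
position {m} e u = Fin.join m m u ↑ˡ e

label-position : ∀ {m} e (u : Fin m ⊎ Fin m) → label m e (position e u) ≡ side u
label-position {m} e u = trans (label-↑ˡ e (Fin.join m m u)) (cong side (FinP.splitAt-join m m u))

entry-padding : ∀ {m} (l : Label m) → entry l padding ≡ false
entry-padding (X _)   = refl
entry-padding (Y _)   = refl
entry-padding padding = refl

entry-diagonal : ∀ {m} (u : Fin m ⊎ Fin m) → entry (side u) (side u) ≡ true
entry-diagonal (inj₁ t) = dec-true (t Fin.≤? t) FinP.≤-refl
entry-diagonal (inj₂ t) = dec-true (t Fin.≤? t) FinP.≤-refl

does∧does≡false : ∀ {A B : Set} (a? : Dec A) (b? : Dec B) → ¬ (A × B) → does a? ∧ does b? ≡ false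
does∧does≡false (yes a) (yes b) ¬a×b = ⊥-elim (¬a×b (a , b))
does∧does≡false (yes _) (no _)  _    = refl
does∧does≡false (no _)  _       _    = refl

not-does∧not-does≡false : ∀ {A B : Set} (a? : Dec A) (b? : Dec B) → A ⊎ B → not (does a?) ∧ not (does b?) ≡ false
not-does∧not-does≡false (yes _) _       _         = refl
not-does∧not-does≡false (no _)  (yes _) _         = refl
not-does∧not-does≡false (no ¬a) (no _)  (inj₁ a)  = ⊥-elim (¬a a)
not-does∧not-does≡false (no _)  (no ¬b) (inj₂ b)  = ⊥-elim (¬b b)

entry-fool : ∀ {m} (u v : Fin m ⊎ Fin m) → u ≢ v → entry (side u) (side v) ∧ entry (side v) (side u) ≡ false
entry-fool (inj₁ t) (inj₁ u) t≢u =
  does∧does≡false (u Fin.≤? t) (t Fin.≤? u) (λ (u≤t , t≤u) → t≢u (cong inj₁ (FinP.≤-antisym t≤u u≤t)))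
entry-fool (inj₂ t) (inj₂ u) t≢u =
  does∧does≡false (u Fin.≤? t) (t Fin.≤? u) (λ (u≤t , t≤u) → t≢u (cong inj₂ (FinP.≤-antisym t≤u u≤t)))
entry-fool (inj₁ t) (inj₂ u) _ = not-does∧not-does≡false (u Fin.≤? t) (t Fin.≤? u) (FinP.≤-total u t)
entry-fool (inj₂ t) (inj₁ u) _ = not-does∧not-does≡false (u Fin.≤? t) (t Fin.≤? u) (FinP.≤-total u t)

twinStaircase-foolingSet : ∀ m e → FoolingSet (twinStaircase m e) (m + m)
twinStaircase-foolingSet m e = record
  { row  = _↑ˡ e
  ; col  = _↑ˡ e
  ; hit  = λ a → trans (cong₂ entry (label-↑ˡ {m} e a) (label-↑ˡ {m} e a)) (entry-diagonal (Fin.splitAt m a))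
  ; fool = λ a b a≢b → trans (cong₂ (λ l l′ → entry l l′ ∧ entry l′ l) (label-↑ˡ {m} e a) (label-↑ˡ {m} e b))
                             (entry-fool _ _ (a≢b ∘ splitAt-injective))
  }
  where
  splitAt-injective : ∀ {a b} → Fin.splitAt m a ≡ Fin.splitAt m b → a ≡ b
  splitAt-injective {a} {b} eq =
    trans (sym (FinP.join-splitAt m m a)) (trans (cong (Fin.join m m) eq) (FinP.join-splitAt m m b))

twinStaircase-support : ∀ m e → NonzeroColumnsAmong (twinStaircase m e) (_↑ˡ e)
twinStaircase-support m e j with Fin.splitAt (m + m) j in eq
... | inj₁ a = inj₁ (a , FinP.splitAt⁻¹-↑ˡ eq)
... | inj₂ _ = inj₂ λ i → entry-padding (label m e i)

occupied : ∀ {m} → Label m → Bool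
occupied padding = false
occupied _       = true

-- Generator zero is the indicator of the unpadded rows, which is X u + Y u for every u.
generatorLabel : ∀ {m} → Fin (suc m) → Label m → ℚ
generatorLabel zero    l = toℚ (occupied l)
generatorLabel (suc u) l = toℚ (entry l (X u))

coordinatesLabel : ∀ {m} → Label m → Fin (suc m) → ℚ
coordinatesLabel (X u)   = unit (suc u)
coordinatesLabel (Y u) t = unit zero t ℚ.- unit (suc u) t
coordinatesLabel padding _ = 0ℚ

toℚ-not : ∀ b → toℚ (not b) ≡ 1ℚ ℚ.- toℚ b
toℚ-not true  = refl
toℚ-not false = refl

entry-Y : ∀ {m} (l : Label m) u → toℚ (entry l (Y u)) ≡ toℚ (occupied l) ℚ.- toℚ (entry l (X u))
entry-Y (X t)   u = toℚ-not (does (u Fin.≤? t))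
entry-Y (Y t)   u = trans (cong toℚ (sym (BoolP.not-involutive _))) (toℚ-not (not (does (u Fin.≤? t))))
entry-Y padding u = refl

entry-spanned : ∀ {m} (l l′ : Label m) → toℚ (entry l l′) ≡ lincomb (coordinatesLabel l′) generatorLabel l
entry-spanned l (X u) = sym (lincomb-unit (suc u) generatorLabel l)
entry-spanned l (Y u) = begin
  toℚ (entry l (Y u))
    ≡⟨ entry-Y l u ⟩
  generatorLabel zero l ℚ.- generatorLabel (suc u) l
    ≡⟨ cong₂ ℚ._-_ (lincomb-unit zero generatorLabel l) (lincomb-unit (suc u) generatorLabel l) ⟨
  lincomb (unit zero) generatorLabel l ℚ.- lincomb (unit (suc u)) generatorLabel l
    ≡⟨ lincomb-− (unit zero) (unit (suc u)) generatorLabel l ⟨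
  lincomb (coordinatesLabel (Y u)) generatorLabel l ∎
  where open ≡-Reasoning
entry-spanned l padding =
  trans (cong toℚ (entry-padding l)) (sym (ℚΣ.sum-zero _ (λ t → ℚP.*-zeroˡ (generatorLabel t l))))

twinStaircase-spannedBy : ∀ m e → SpannedBy (twinStaircase m e) (suc m)
twinStaircase-spannedBy m e = record
  { generator   = λ t i → generatorLabel t (label m e i)
  ; coordinates = coordinatesLabel ∘ label m e
  ; spans       = λ j i → entry-spanned (label m e i) (label m e j)
  }

basisSide : ∀ {m} → Fin (suc (suc m)) → Fin (suc m) ⊎ Fin (suc m)
basisSide zero    = inj₂ zero
basisSide (suc t) = inj₁ t

-- Row X a misses the column Y 0 and meets the X-columns in the unitriangular pattern u ≤ a, so the
-- X-coefficients vanish by strong induction on a; row Y 0 then isolates the coefficient of Y 0.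
basis-independent : ∀ {m} → Independent (λ t u → toℚ (entry (side u) (side (basisSide {m} t))))
basis-independent {m} c c·v≡0 = coefficient
  where
  v : Fin (suc (suc m)) → Fin (suc m) ⊎ Fin (suc m) → ℚ
  v t u = toℚ (entry (side u) (side (basisSide t)))
  X-coefficient : ∀ a → c (suc a) ≡ 0ℚ
  X-coefficient = All.wfRec FinInduction.<-wellFounded _ (λ a → c (suc a) ≡ 0ℚ) step
    where
    step : ∀ a → WfRec Fin._<_ (λ a → c (suc a) ≡ 0ℚ) a → c (suc a) ≡ 0ℚ
    step a below = begin
      c (suc a)                          ≡⟨ ℚP.*-identityʳ (c (suc a)) ⟨
      c (suc a) ℚ.* 1ℚ                   ≡⟨ cong (λ b → c (suc a) ℚ.* toℚ b) (dec-true (a Fin.≤? a) FinP.≤-refl) ⟨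
      c (suc a) ℚ.* v (suc a) (inj₁ a)   ≡⟨ lincomb-isolate c v (inj₁ a) (suc a) off-diagonal ⟨
      lincomb c v (inj₁ a)               ≡⟨ c·v≡0 (inj₁ a) ⟩
      0ℚ                                 ∎
      where
      open ≡-Reasoning
      off-diagonal : ∀ t → t ≢ suc a → c t ℚ.* v t (inj₁ a) ≡ 0ℚ
      off-diagonal zero    _ = ℚP.*-zeroʳ (c zero)
      off-diagonal (suc b) b≢a = vanish (b Fin.≤? a)
        where
        vanish : (b≤?a : Dec (b Fin.≤ a)) → c (suc b) ℚ.* toℚ (does b≤?a) ≡ 0ℚ
        vanish (yes b≤a) = trans (cong (ℚ._* 1ℚ) (below (FinP.≤∧≢⇒< b≤a (b≢a ∘ cong suc)))) (ℚP.*-zeroˡ 1ℚ)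
        vanish (no _)    = ℚP.*-zeroʳ (c (suc b))
  Y-coefficient : c zero ≡ 0ℚ
  Y-coefficient = begin
    c zero                        ≡⟨ ℚP.*-identityʳ (c zero) ⟨
    c zero ℚ.* v zero (inj₂ zero) ≡⟨ lincomb-isolate c v (inj₂ zero) zero off-diagonal ⟨
    lincomb c v (inj₂ zero)       ≡⟨ c·v≡0 (inj₂ zero) ⟩
    0ℚ                            ∎
    where
    open ≡-Reasoning
    off-diagonal : ∀ t → t ≢ zero → c t ℚ.* v t (inj₂ zero) ≡ 0ℚ
    off-diagonal zero    0≢0 = ⊥-elim (0≢0 refl)
    off-diagonal (suc b) _   =
      trans (cong (ℚ._* v (suc b) (inj₂ zero)) (X-coefficient b)) (ℚP.*-zeroˡ (v (suc b) (inj₂ zero)))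
  coefficient : ∀ t → c t ≡ 0ℚ
  coefficient zero    = Y-coefficient
  coefficient (suc a) = X-coefficient a

twinStaircase-independentColumns : ∀ m e → IndependentColumns (twinStaircase (suc m) e) (suc (suc m))
twinStaircase-independentColumns m e =
  position e ∘ basisSide ,
  Independent-restrict {v = columns (twinStaircase (suc m) e) (position e ∘ basisSide)} (position e)
    (λ t u → cong₂ (λ l l′ → toℚ (entry l l′)) (label-position e u) (label-position e (basisSide t)))
    basis-independent

twinStaircase-kpow-ranks : ∀ m e k →
  HasRankℚ (kpow k (twinStaircase (suc m) e)) ((suc m + 1) ^ k) ×
  HasBinRank (kpow k (twinStaircase (suc m) e)) ((2 * suc m) ^ k)
twinStaircase-kpow-ranks m e k =
  subst (λ r → HasRankℚ (kpow k M) (r ^ k)) (ℕP.+-comm 1 (suc m))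
        (independent∧spanned⇒HasRankℚ (IndependentColumns-kpow (twinStaircase-independentColumns m e) k)
                                      (SpannedBy-kpow (twinStaircase-spannedBy (suc m) e) k)) ,
  subst (λ s → HasBinRank (kpow k M) (s ^ k)) (cong (suc m +_) (sym (ℕP.+-identityʳ (suc m))))
        (foolingSet⇒HasBinRank (FoolingSet-kpow F k)
                               (NonzeroColumnsAmong-kpow F (twinStaircase-support (suc m) e) k))
  where
  M : Mat01 (suc m + suc m + e) (suc m + suc m + e)
  M = twinStaircase (suc m) e
  F : FoolingSet M (suc m + suc m)
  F = twinStaircase-foolingSet (suc m) e

-- The construction works for every n ≥ 2 and every k.
mainTheorem13 : (n : ℕ) → 4 ≤ n → n ≢ 5 →
    Σ (Mat01 n n) λ M → (k : ℕ) → 1 ≤ k →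
      HasRankℚ (kpow k M) ((⌊ n /2⌋ + 1) ^ k) ×
      HasBinRank (kpow k M) ((2 * ⌊ n /2⌋) ^ k)
mainTheorem13 (suc (suc n)) (ℕ.s≤s (ℕ.s≤s _)) _ =
  subst (λ N → Σ (Mat01 N N) λ M → (k : ℕ) → 1 ≤ k →
                 HasRankℚ (kpow k M) ((m + 1) ^ k) × HasBinRank (kpow k M) ((2 * m) ^ k))
        (ℕP.m+[n∸m]≡n m+m≤n)
        (twinStaircase m e , λ k _ → twinStaircase-kpow-ranks ⌊ n /2⌋ e k)
  where
  m e : ℕ
  m = ⌊ suc (suc n) /2⌋
  e = suc (suc n) ∸ (m + m)
  m+m≤n : m + m ≤ suc (suc n)
  m+m≤n = subst (m + m ≤_) (ℕP.⌊n/2⌋+⌈n/2⌉≡n (suc (suc n))) (ℕP.+-monoʳ-≤ m (ℕP.⌊n/2⌋≤⌈n/2⌉ (suc (suc n))))
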